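{- Let $G=(V,E)$ be an undirected graph with $m$ edges, $n$ vertices and positive integer edge weights $w$, and terminal set $T\subseteq V$. Let $N$ be an integer larger than the sum of all edge weights, and define perturbed weights $\widetilde{w}(u,v)=mN\cdot w(u,v)+r(u,v)$ where each $r(u,v)\in\{1,\dots,N\}$. If $X$ is an extreme set under edge weights $w$, then $X$ remains extreme under edge weights $\widetilde{w}$.
   Context: For weights $w$ and $X\subseteq V$, $d(X)$ is the total $w$-weight of edges with exactly one endpoint in $X$; $\widetilde d$ is the same with $\widetilde w$. A Steiner cut is a set $X\subseteq V$ with $X\cap T\neq\emptyset$ and $T\not\subseteq X$. A Steiner cut $X$ is extreme under a weight function if every Steiner cut $Y\subsetneq X$ has strictly larger cut value than $X$ under that weight function. -}

module Defs where

open import Data.Nat using (ℕ; _+_; _*_; _<_)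
open import Data.Bool using (Bool; true; false; _xor_; if_then_else_)
open import Data.Fin using (Fin)
open import Data.Fin.Subset using (Subset; _∩_; _⊆_; _⊂_; Nonempty)
open import Data.Vec using (lookup)
open import Data.List using (tabulate)
open import Data.Nat.ListAction using (sum)
open import Data.Product using (_×_; proj₁; proj₂)
open import Relation.Nullary using (¬_)

-- An undirected (multi)graph on vertex set Fin n with m edges;
-- edge e has endpoints (proj₁ (ends e)) and (proj₂ (ends e)).
Edges : ℕ → ℕ → Set
Edges n m = Fin m → Fin n × Fin n

Σ[e<_]_ : (m : ℕ) → (Fin m → ℕ) → ℕ
Σ[e< m ] f = sum (tabulate f)

crosses : ∀ {n m} → Edges n m → Subset n → Fin m → Bool
crosses E X e = lookup X (proj₁ (E e)) xor lookup X (proj₂ (E e))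

cutValue : ∀ {n m} → Edges n m → (Fin m → ℕ) → Subset n → ℕ
cutValue {m = m} E w X = Σ[e< m ] (λ e → if crosses E X e then w e else 0)

SteinerCut : ∀ {n} → Subset n → Subset n → Set
SteinerCut T X = Nonempty (X ∩ T) × ¬ (T ⊆ X)

Extreme : ∀ {n m} → Edges n m → (Fin m → ℕ) → Subset n → Subset n → Set
Extreme E w T X =
  SteinerCut T X ×
  (∀ Y → SteinerCut T Y → Y ⊂ X → cutValue E w X < cutValue E w Y)

perturb : ∀ {m} → ℕ → (Fin m → ℕ) → (Fin m → ℕ) → Fin m → ℕ
perturb {m} N w r e = m * N * w e + r e

{-# OPTIONS --safe #-}
-- Write d̃(Y) = mN·d(Y) + ρ(Y), where ρ(Y) is the r-weight of the cut of Y.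
-- Since 1 ≤ r ≤ N on each of the m edges, 0 ≤ ρ(Y) ≤ mN, and ρ(Y) ≥ 1 as soon as
-- d(Y) ≥ 1.  Hence d(X) < d(Y) gives d̃(X) ≤ mN·(d(X) + 1) ≤ mN·d(Y) < d̃(Y), so
-- every strict inequality between cut values, and with it extremality, survives
-- the perturbation.
module Submission where

open import Defs
open import Data.Nat using (ℕ; _≤_; _<_; zero; suc; _+_; _*_; z≤n; s≤s)
open import Data.Nat.Properties
open import Algebra.Properties.CommutativeSemigroup +-commutativeSemigroup
  using (interchange)
open import Data.Fin using (Fin)
import Data.Fin as Fin
open import Data.Fin.Subset using (Subset)
open import Data.Bool using (Bool; true; false; if_then_else_)
open import Data.Product using (_×_; _,_; proj₁; proj₂)
open import Relation.Binary.PropositionalEquality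
  using (_≡_; refl; sym; cong; cong₂; subst; module ≡-Reasoning)

Σ-cong : ∀ k {f g : Fin k → ℕ} → (∀ e → f e ≡ g e) → Σ[e< k ] f ≡ Σ[e< k ] g
Σ-cong zero    f≗g = refl
Σ-cong (suc k) f≗g = cong₂ _+_ (f≗g Fin.zero) (Σ-cong k (λ e → f≗g (Fin.suc e)))

Σ-distrib-+ : ∀ k (f g : Fin k → ℕ) →
  Σ[e< k ] (λ e → f e + g e) ≡ Σ[e< k ] f + Σ[e< k ] g
Σ-distrib-+ zero    f g = refl
Σ-distrib-+ (suc k) f g = begin
  f Fin.zero + g Fin.zero + Σ[e< k ] (λ e → f (Fin.suc e) + g (Fin.suc e))
    ≡⟨ cong (f Fin.zero + g Fin.zero +_) (Σ-distrib-+ k (f ∘suc) (g ∘suc)) ⟩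
  f Fin.zero + g Fin.zero + (Σ[e< k ] (f ∘suc) + Σ[e< k ] (g ∘suc))
    ≡⟨ interchange (f Fin.zero) (g Fin.zero) _ _ ⟩
  f Fin.zero + Σ[e< k ] (f ∘suc) + (g Fin.zero + Σ[e< k ] (g ∘suc)) ∎
  where
  open ≡-Reasoning
  _∘suc : (Fin (suc k) → ℕ) → Fin k → ℕ
  (h ∘suc) e = h (Fin.suc e)

Σ-*ˡ : ∀ k a (f : Fin k → ℕ) → Σ[e< k ] (λ e → a * f e) ≡ a * Σ[e< k ] f
Σ-*ˡ zero    a f = sym (*-zeroʳ a)
Σ-*ˡ (suc k) a f = begin
  a * f Fin.zero + Σ[e< k ] (λ e → a * f (Fin.suc e))
    ≡⟨ cong (a * f Fin.zero +_) (Σ-*ˡ k a (λ e → f (Fin.suc e))) ⟩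
  a * f Fin.zero + a * Σ[e< k ] (λ e → f (Fin.suc e))
    ≡⟨ sym (*-distribˡ-+ a (f Fin.zero) _) ⟩
  a * (f Fin.zero + Σ[e< k ] (λ e → f (Fin.suc e))) ∎
  where open ≡-Reasoning

Σ-≤-* : ∀ k c (f : Fin k → ℕ) → (∀ e → f e ≤ c) → Σ[e< k ] f ≤ k * c
Σ-≤-* zero    c f f≤c = z≤n
Σ-≤-* (suc k) c f f≤c =
  +-mono-≤ (f≤c Fin.zero) (Σ-≤-* k c (λ e → f (Fin.suc e)) (λ e → f≤c (Fin.suc e)))

Σ-positive-mono : ∀ k (f g : Fin k → ℕ) → (∀ e → 0 < f e → 0 < g e) →
  0 < Σ[e< k ] f → 0 < Σ[e< k ] g
Σ-positive-mono (suc k) f g f⇒g 0<Σf with f Fin.zero in f₀≡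
... | suc _ = ≤-trans (f⇒g Fin.zero (subst (0 <_) (sym f₀≡) (s≤s z≤n))) (m≤m+n _ _)
... | zero  = ≤-trans
  (Σ-positive-mono k (λ e → f (Fin.suc e)) (λ e → g (Fin.suc e)) (λ e → f⇒g (Fin.suc e)) 0<Σf)
  (m≤n+m _ (g Fin.zero))

*-+-<-*-+ : ∀ M {a b x y} → a < b → x ≤ M → 0 < y → M * a + x < M * b + y
*-+-<-*-+ M {a} {b} {x} {y} a<b x≤M 0<y = begin-strict
  M * a + x     ≤⟨ +-monoʳ-≤ (M * a) x≤M ⟩
  M * a + M     ≡⟨ +-comm (M * a) M ⟩
  M + M * a     ≡⟨ *-suc M a ⟨
  M * suc a     ≤⟨ *-monoʳ-≤ M a<b ⟩
  M * b         <⟨ m<m+n (M * b) 0<y ⟩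
  M * b + y     ∎
  where open ≤-Reasoning

if-*-+ : ∀ (c : Bool) M u v →
  (if c then M * u + v else 0) ≡ M * (if c then u else 0) + (if c then v else 0)
if-*-+ true  M u v = refl
if-*-+ false M u v = cong (_+ 0) (sym (*-zeroʳ M))

module _ {n m : ℕ} (E : Edges n m) where

  cutValue-perturb : ∀ N w r Y →
    cutValue E (perturb N w r) Y ≡ m * N * cutValue E w Y + cutValue E r Y
  cutValue-perturb N w r Y = begin
    cutValue E (perturb N w r) Y
      ≡⟨ Σ-cong m (λ e → if-*-+ (crosses E Y e) (m * N) (w e) (r e)) ⟩
    Σ[e< m ] (λ e → m * N * wY e + rY e)
      ≡⟨ Σ-distrib-+ m (λ e → m * N * wY e) rY ⟩
    Σ[e< m ] (λ e → m * N * wY e) + cutValue E r Y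
      ≡⟨ cong (_+ cutValue E r Y) (Σ-*ˡ m (m * N) wY) ⟩
    m * N * cutValue E w Y + cutValue E r Y ∎
    where
    open ≡-Reasoning
    wY rY : Fin m → ℕ
    wY e = if crosses E Y e then w e else 0
    rY e = if crosses E Y e then r e else 0

  cutValue-≤ : ∀ N r → (∀ e → r e ≤ N) → ∀ Y → cutValue E r Y ≤ m * N
  cutValue-≤ N r r≤N Y = Σ-≤-* m N _ bounded
    where
    bounded : ∀ e → (if crosses E Y e then r e else 0) ≤ N
    bounded e with crosses E Y e
    ... | true  = r≤N e
    ... | false = z≤n

  cutValue-positive : ∀ w r → (∀ e → 0 < r e) → ∀ Y →
    0 < cutValue E w Y → 0 < cutValue E r Y
  cutValue-positive w r 0<r Y = Σ-positive-mono m _ _ transfer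
    where
    transfer : ∀ e → 0 < (if crosses E Y e then w e else 0) →
                     0 < (if crosses E Y e then r e else 0)
    transfer e 0<wₑ with crosses E Y e
    ... | true  = 0<r e
    ... | false = 0<wₑ

  perturb-preserves-< : ∀ N w r → (∀ e → 1 ≤ r e × r e ≤ N) → ∀ X Y →
    cutValue E w X < cutValue E w Y →
    cutValue E (perturb N w r) X < cutValue E (perturb N w r) Y
  perturb-preserves-< N w r r∈[1,N] X Y dX<dY
    rewrite cutValue-perturb N w r X | cutValue-perturb N w r Y =
    *-+-<-*-+ (m * N) dX<dY
      (cutValue-≤ N r (λ e → proj₂ (r∈[1,N] e)) X)
      (cutValue-positive w r (λ e → proj₁ (r∈[1,N] e)) Y (≤-trans (s≤s z≤n) dX<dY))

mainTheorem12 : (n m : ℕ) (E : Edges n m) (w : Fin m → ℕ)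
    → (∀ e → 1 ≤ w e)
    → (T : Subset n) (N : ℕ)
    → Σ[e< m ] w < N
    → (r : Fin m → ℕ)
    → (∀ e → 1 ≤ r e × r e ≤ N)
    → (X : Subset n)
    → Extreme E w T X
    → Extreme E (perturb N w r) T X
mainTheorem12 n m E w _ T N _ r r∈[1,N] X (steinerX , minimal) =
  steinerX , λ Y steinerY Y⊂X →
    perturb-preserves-< E N w r r∈[1,N] X Y (minimal Y steinerY Y⊂X)
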